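{- Let $k$ and $r$ be positive integers with $k\geq 2$ and $1\leq r<k-1$, let $D$ be the diameter of $K(2k+r,k)$, and let $p\geq1$ be an integer with $2p\leq D$ such that $2p<D$ or $r$ divides $k-1$. Let $A$ and $B$ be vertices of $K_{=2p}(2k+r,k)$. If there is a path of length $\ell$ from $A$ to $B$ in $K_{=2p}(2k+r,k)$, then $|A\cap B|\geq k-\ell rp$.
   Context: For positive integers $n,k$, $[n]^k$ is the set of $k$-element subsets of $\{1,\dots,n\}$. The Kneser graph $K(2k+r,k)$ has vertex set $[2k+r]^k$, with $A,B$ adjacent iff $A\cap B=\emptyset$; it is connected. For a connected graph $G$ and positive integer $d$, the exact distance-$d$ graph $G_{=d}$ has the same vertex set as $G$, with two vertices adjacent iff their distance in $G$ is exactly $d$. $K_{=d}(2k+r,k)$ denotes the exact distance-$d$ graph of $K(2k+r,k)$. (The diameter of $K(2k+r,k)$ is $\lceil (k-1)/r\rceil+1$.) -}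

module Defs where

open import Data.Nat using (ℕ; zero; suc; _+_; _*_; _∸_; _≤_)
open import Data.Nat.DivMod using (_/_)
open import Data.Fin using (Fin; zero; suc; fromℕ; inject₁)
open import Data.Fin.Subset using (Subset; _∩_; ∣_∣; Empty)
open import Data.Product using (Σ; _×_; proj₁)
open import Relation.Binary.PropositionalEquality using (_≡_)
open import Function.Definitions using (Injective)

Vertex : ℕ → ℕ → Set
Vertex n k = Σ (Subset n) (λ A → ∣ A ∣ ≡ k)

Disjoint : ∀ {n} → Subset n → Subset n → Set
Disjoint A B = Empty (A ∩ B)

data KWalk (n k : ℕ) : Subset n → Subset n → ℕ → Set where
  here : ∀ {A} → KWalk n k A A 0
  step : ∀ {A C B m} → ∣ C ∣ ≡ k → Disjoint A C → KWalk n k C B m → KWalk n k A B (suc m)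

KDist : (n k : ℕ) → Subset n → Subset n → ℕ → Set
KDist n k A B d = KWalk n k A B d × (∀ m → KWalk n k A B m → d ≤ m)

ExactAdj : (n k d : ℕ) → Vertex n k → Vertex n k → Set
ExactAdj n k d A B = KDist n k (proj₁ A) (proj₁ B) d

ExactPath : (n k d : ℕ) → Vertex n k → Vertex n k → ℕ → Set
ExactPath n k d A B ℓ =
  Σ (Fin (suc ℓ) → Vertex n k) λ v →
    (v zero ≡ A) × (v (fromℕ ℓ) ≡ B)
    × (∀ (i : Fin ℓ) → ExactAdj n k d (v (inject₁ i)) (v (suc i)))
    × Injective _≡_ _≡_ (λ i → proj₁ (v i))

-- Diameter of K(2k+r,k): ⌈(k-1)/r⌉ + 1 (r ≥ 1; value at r = 0 is junk).
diamK : ℕ → ℕ → ℕ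
diamK k zero = 0
diamK k (suc r') = ((k ∸ 1) + r') / suc r' + 1

{-# OPTIONS --safe #-}
module Submission where

-- For k-sets, k − |A ∩ B| is half the symmetric difference of A and B, so it
-- satisfies the triangle inequality. Two Kneser steps A – C – B put A and B
-- inside the (k + r)-element complement of C, whence |A ∩ B| ≥ k − r. So the
-- ends of a walk of length 2m share at least k − mr elements, and each edge of
-- K_{=2p} is in particular a walk of length 2p.

open import Defs
open import Algebra.Properties.CommutativeSemigroup as CommSemigroupProperties using ()
open import Data.Fin using (Fin; zero; suc; fromℕ; inject₁)
open import Data.Fin.Subset using (Subset; inside; outside; _∩_; _∪_; _⊆_; ∣_∣; Empty)
open import Data.Fin.Subset.Properties
  using ( p⊆q⇒∣p∣≤∣q∣; ∣p∣≤n; ∣⊥∣≡0; Empty-unique; ∩-comm; ∩-idem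
        ; p∩q⊆p; p∩q⊆q; x∈p∩q⁺; x∈p∩q⁻; x∈p∪q⁻)
open import Data.Nat using (ℕ; zero; suc; _+_; _*_; _∸_; _≤_; _<_)
open import Data.Nat.Divisibility using (_∣_)
open import Data.Nat.Properties
  using ( +-suc; +-assoc; +-identityʳ; *-comm; *-assoc; +-mono-≤; +-monoˡ-≤; +-monoʳ-≤
        ; +-cancelˡ-≤; ≤-reflexive; ≤-trans; m≤n+o⇒m∸n≤o; +-commutativeSemigroup; module ≤-Reasoning)
open import Data.Product using (_,_; proj₁; proj₂)
open import Data.Sum using (_⊎_; [_,_])
open import Data.Vec using (_∷_; [])
open import Relation.Binary.PropositionalEquality
  using (_≡_; refl; sym; trans; cong; cong₂; subst)

open CommSemigroupProperties +-commutativeSemigroup using (interchange; x∙yz≈y∙xz; xy∙z≈xz∙y)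

∣p∪q∣+∣p∩q∣≡∣p∣+∣q∣ : ∀ {n} (p q : Subset n) → ∣ p ∪ q ∣ + ∣ p ∩ q ∣ ≡ ∣ p ∣ + ∣ q ∣
∣p∪q∣+∣p∩q∣≡∣p∣+∣q∣ []            []            = refl
∣p∪q∣+∣p∩q∣≡∣p∣+∣q∣ (inside ∷ p)  (inside ∷ q)  =
  cong suc (trans (+-suc _ _) (trans (cong suc (∣p∪q∣+∣p∩q∣≡∣p∣+∣q∣ p q)) (sym (+-suc _ _))))
∣p∪q∣+∣p∩q∣≡∣p∣+∣q∣ (inside ∷ p)  (outside ∷ q) = cong suc (∣p∪q∣+∣p∩q∣≡∣p∣+∣q∣ p q)
∣p∪q∣+∣p∩q∣≡∣p∣+∣q∣ (outside ∷ p) (inside ∷ q)  =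
  trans (cong suc (∣p∪q∣+∣p∩q∣≡∣p∣+∣q∣ p q)) (sym (+-suc _ _))
∣p∪q∣+∣p∩q∣≡∣p∣+∣q∣ (outside ∷ p) (outside ∷ q) = ∣p∪q∣+∣p∩q∣≡∣p∣+∣q∣ p q

Disjoint-sym : ∀ {n} {p q : Subset n} → Disjoint p q → Disjoint q p
Disjoint-sym {p = p} {q} = subst Empty (∩-comm p q)

∪-Disjoint : ∀ {n} {p q r : Subset n} → Disjoint p r → Disjoint q r → Disjoint (p ∪ q) r
∪-Disjoint {p = p} {q} {r} p∩r≡∅ q∩r≡∅ (x , x∈p∪q∩r) with x∈p∩q⁻ (p ∪ q) r x∈p∪q∩r
... | x∈p∪q , x∈r =
  [ (λ x∈p → p∩r≡∅ (x , x∈p∩q⁺ (x∈p , x∈r))) , (λ x∈q → q∩r≡∅ (x , x∈p∩q⁺ (x∈q , x∈r))) ]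
    (x∈p∪q⁻ p q x∈p∪q)

Disjoint⇒∣p∣+∣q∣≤n : ∀ {n} {p q : Subset n} → Disjoint p q → ∣ p ∣ + ∣ q ∣ ≤ n
Disjoint⇒∣p∣+∣q∣≤n {n} {p} {q} p∩q≡∅ = begin
  ∣ p ∣ + ∣ q ∣          ≡⟨ sym (∣p∪q∣+∣p∩q∣≡∣p∣+∣q∣ p q) ⟩
  ∣ p ∪ q ∣ + ∣ p ∩ q ∣  ≡⟨ cong (∣ p ∪ q ∣ +_) (trans (cong ∣_∣ (Empty-unique p∩q≡∅)) (∣⊥∣≡0 n)) ⟩
  ∣ p ∪ q ∣ + 0          ≡⟨ +-identityʳ _ ⟩
  ∣ p ∪ q ∣              ≤⟨ ∣p∣≤n (p ∪ q) ⟩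
  n                      ∎
  where open ≤-Reasoning

∣p∣+∣q∣+∣r∣≤n+∣p∩q∣ : ∀ {n} {p q r : Subset n} → Disjoint p r → Disjoint r q →
                      ∣ p ∣ + ∣ q ∣ + ∣ r ∣ ≤ n + ∣ p ∩ q ∣
∣p∣+∣q∣+∣r∣≤n+∣p∩q∣ {n} {p} {q} {r} p∩r≡∅ r∩q≡∅ = begin
  ∣ p ∣ + ∣ q ∣ + ∣ r ∣              ≡⟨ cong (_+ ∣ r ∣) (sym (∣p∪q∣+∣p∩q∣≡∣p∣+∣q∣ p q)) ⟩
  ∣ p ∪ q ∣ + ∣ p ∩ q ∣ + ∣ r ∣      ≡⟨ xy∙z≈xz∙y (∣ p ∪ q ∣) (∣ p ∩ q ∣) (∣ r ∣) ⟩
  ∣ p ∪ q ∣ + ∣ r ∣ + ∣ p ∩ q ∣      ≤⟨ +-monoˡ-≤ (∣ p ∩ q ∣) p∪q+r≤n ⟩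
  n + ∣ p ∩ q ∣                      ∎
  where
  open ≤-Reasoning
  p∪q+r≤n : ∣ p ∪ q ∣ + ∣ r ∣ ≤ n
  p∪q+r≤n = Disjoint⇒∣p∣+∣q∣≤n (∪-Disjoint p∩r≡∅ (Disjoint-sym r∩q≡∅))

∣p∩q∣+∣q∩r∣≤∣q∣+∣p∩r∣ : ∀ {n} (p q r : Subset n) → ∣ p ∩ q ∣ + ∣ q ∩ r ∣ ≤ ∣ q ∣ + ∣ p ∩ r ∣
∣p∩q∣+∣q∩r∣≤∣q∣+∣p∩r∣ p q r = begin
  ∣ p ∩ q ∣ + ∣ q ∩ r ∣                          ≡⟨ sym (∣p∪q∣+∣p∩q∣≡∣p∣+∣q∣ (p ∩ q) (q ∩ r)) ⟩
  ∣ (p ∩ q) ∪ (q ∩ r) ∣ + ∣ (p ∩ q) ∩ (q ∩ r) ∣  ≤⟨ +-mono-≤ (p⊆q⇒∣p∣≤∣q∣ ∪⊆q) (p⊆q⇒∣p∣≤∣q∣ ∩⊆p∩r) ⟩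
  ∣ q ∣ + ∣ p ∩ r ∣                              ∎
  where
  open ≤-Reasoning
  ∪⊆q : (p ∩ q) ∪ (q ∩ r) ⊆ q
  ∪⊆q x∈ = [ p∩q⊆q p q , p∩q⊆p q r ] (x∈p∪q⁻ (p ∩ q) (q ∩ r) x∈)
  ∩⊆p∩r : (p ∩ q) ∩ (q ∩ r) ⊆ p ∩ r
  ∩⊆p∩r x∈ = x∈p∩q⁺ ( p∩q⊆p p q (proj₁ (x∈p∩q⁻ (p ∩ q) (q ∩ r) x∈))
                     , p∩q⊆q q r (proj₂ (x∈p∩q⁻ (p ∩ q) (q ∩ r) x∈)))

-- |A ∩ B| ≥ k − d, stated additively to avoid truncated subtraction.
record Close {n} (k d : ℕ) (A B : Subset n) : Set where
  constructor close
  field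
    bound : k ≤ d + ∣ A ∩ B ∣

Close-refl : ∀ {n k} {A : Subset n} → ∣ A ∣ ≡ k → Close k 0 A A
Close-refl {A = A} ∣A∣≡k = close (≤-reflexive (sym (trans (cong ∣_∣ (∩-idem A)) ∣A∣≡k)))

Close-trans : ∀ {n k d e} {A B C : Subset n} → ∣ B ∣ ≡ k →
              Close k d A B → Close k e B C → Close k (d + e) A C
Close-trans {k = k} {d} {e} {A} {B} {C} ∣B∣≡k (close AB) (close BC) =
  close (+-cancelˡ-≤ k _ _ (begin
  k + k                                      ≤⟨ +-mono-≤ AB BC ⟩
  (d + ∣ A ∩ B ∣) + (e + ∣ B ∩ C ∣)          ≡⟨ interchange d (∣ A ∩ B ∣) e (∣ B ∩ C ∣) ⟩
  (d + e) + (∣ A ∩ B ∣ + ∣ B ∩ C ∣)          ≤⟨ +-monoʳ-≤ (d + e) (∣p∩q∣+∣q∩r∣≤∣q∣+∣p∩r∣ A B C) ⟩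
  (d + e) + (∣ B ∣ + ∣ A ∩ C ∣)              ≡⟨ cong (λ b → (d + e) + (b + ∣ A ∩ C ∣)) ∣B∣≡k ⟩
  (d + e) + (k + ∣ A ∩ C ∣)                  ≡⟨ x∙yz≈y∙xz (d + e) k (∣ A ∩ C ∣) ⟩
  k + ((d + e) + ∣ A ∩ C ∣)                  ∎))
  where open ≤-Reasoning

module _ {k r : ℕ} where

  Close-commonNeighbour : {A B C : Subset (2 * k + r)} → ∣ A ∣ ≡ k → ∣ B ∣ ≡ k → ∣ C ∣ ≡ k →
                          Disjoint A C → Disjoint C B → Close k r A B
  Close-commonNeighbour {A} {B} {C} ∣A∣≡k ∣B∣≡k ∣C∣≡k A∩C≡∅ C∩B≡∅ =
    close (+-cancelˡ-≤ (k + k) _ _ (begin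
    k + k + k                    ≡⟨ sym (cong₂ _+_ (cong₂ _+_ ∣A∣≡k ∣B∣≡k) ∣C∣≡k) ⟩
    ∣ A ∣ + ∣ B ∣ + ∣ C ∣        ≤⟨ ∣p∣+∣q∣+∣r∣≤n+∣p∩q∣ A∩C≡∅ C∩B≡∅ ⟩
    2 * k + r + ∣ A ∩ B ∣        ≡⟨ +-assoc (2 * k) r (∣ A ∩ B ∣) ⟩
    2 * k + (r + ∣ A ∩ B ∣)      ≡⟨ cong (λ x → k + x + (r + ∣ A ∩ B ∣)) (+-identityʳ k) ⟩
    k + k + (r + ∣ A ∩ B ∣)      ∎))
    where open ≤-Reasoning

  -- The length is written m * 2 so that suc m * 2 unfolds to two steps.
  KWalk⇒Close : ∀ m {A B : Subset (2 * k + r)} → ∣ A ∣ ≡ k → ∣ B ∣ ≡ k →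
                KWalk (2 * k + r) k A B (m * 2) → Close k (m * r) A B
  KWalk⇒Close zero    ∣A∣≡k _ here = Close-refl ∣A∣≡k
  KWalk⇒Close (suc m) ∣A∣≡k ∣B∣≡k (step ∣C∣≡k A∩C≡∅ (step ∣C′∣≡k C∩C′≡∅ walk)) =
    Close-trans ∣C′∣≡k (Close-commonNeighbour ∣A∣≡k ∣C′∣≡k ∣C∣≡k A∩C≡∅ C∩C′≡∅)
                       (KWalk⇒Close m ∣C′∣≡k ∣B∣≡k walk)

  ExactAdj⇒Close : ∀ p {A B : Vertex (2 * k + r) k} →
                   ExactAdj (2 * k + r) k (2 * p) A B → Close k (p * r) (proj₁ A) (proj₁ B)
  ExactAdj⇒Close p {A , ∣A∣≡k} {B , ∣B∣≡k} (walk , _) =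
    KWalk⇒Close p ∣A∣≡k ∣B∣≡k (subst (KWalk (2 * k + r) k A B) (*-comm 2 p) walk)

  ExactWalk⇒Close : ∀ p ℓ (v : Fin (suc ℓ) → Vertex (2 * k + r) k) →
                    (∀ i → ExactAdj (2 * k + r) k (2 * p) (v (inject₁ i)) (v (suc i))) →
                    Close k (ℓ * (p * r)) (proj₁ (v zero)) (proj₁ (v (fromℕ ℓ)))
  ExactWalk⇒Close p zero    v _   = Close-refl (proj₂ (v zero))
  ExactWalk⇒Close p (suc ℓ) v adj =
    Close-trans (proj₂ (v (suc zero))) (ExactAdj⇒Close p {v zero} {v (suc zero)} (adj zero))
                (ExactWalk⇒Close p ℓ (λ i → v (suc i)) (λ i → adj (suc i)))

mainTheorem8 : (k r p ℓ : ℕ) → 2 ≤ k → 1 ≤ r → r + 1 < k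
  → 1 ≤ p → 2 * p ≤ diamK k r → (2 * p < diamK k r ⊎ r ∣ k ∸ 1)
  → (A B : Vertex (2 * k + r) k)
  → ExactPath (2 * k + r) k (2 * p) A B ℓ
  → k ∸ ℓ * r * p ≤ ∣ proj₁ A ∩ proj₁ B ∣
mainTheorem8 k r p ℓ _ _ _ _ _ _ _ _ (v , refl , refl , adj , _) =
  m≤n+o⇒m∸n≤o k (ℓ * r * p)
    (≤-trans (Close.bound (ExactWalk⇒Close {k} {r} p ℓ v adj)) (+-monoˡ-≤ _ (≤-reflexive ℓpr≡ℓrp)))
  where
  ℓpr≡ℓrp : ℓ * (p * r) ≡ ℓ * r * p
  ℓpr≡ℓrp = trans (cong (ℓ *_) (*-comm p r)) (sym (*-assoc ℓ r p))
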